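{- Let $n\ge 3$ and $k\in\{2,\ldots,n-1\}$, and let $T^{k,n}$ be the problem instance defined in the context. Let $N^a$ be any output of Algorithm 1 on input $T^{k,n}$, i.e., a CPT such that, writing $T^{k,n}=(N_1,\ldots,N_t)$ and letting, for each $s$, $N^*_s$ be a CPT minimizing $f_{T^{k,n}}$ among all CPTs for $V_n$ whose parent set is contained in $Pa(N_s,V_n)$, we have $N^a=N^*_{s^*}$ for some $s^*$ with $f_{T^{k,n}}(N^*_{s^*})=\min_{1\le s\le t}f_{T^{k,n}}(N^*_s)$. Then $N^a$ is an optimal solution for $T^{k,n}$.
   Context: Binary attributes $V_1,\ldots,V_n$, each with domain $\{0,1\}$. For $Q\subseteq\{V_1,\ldots,V_{n-1}\}$, $\mathrm{Inst}(Q)$ is the set of assignments of values in $\{0,1\}$ to the attributes of $Q$ (contexts). A (complete) CPT $N$ for $V_n$ consists of a parent set $Pa(N,V_n)\subseteq\{V_1,\ldots,V_{n-1}\}$ and, for each $\gamma\in\mathrm{Inst}(Pa(N,V_n))$, exactly one rule, either $\gamma:0\succ 1$ or $\gamma:1\succ 0$. A swap over $V_n$ is identified with an element $x\in\{0,1\}^{n-1}$; the vote of $N$ on $x$ is $0$ if the rule of $N$ whose context agrees with $x$ on $Pa(N,V_n)$ is of the form $\gamma:0\succ1$, and $1$ otherwise. $\Delta(N,N')$ is the number of swaps on which $N,N'$ vote differently. For a problem instance $T=(N_1,\ldots,N_t)$ (tuple of CPTs for $V_n$), $f_T(N)=\sum_{s=1}^t\Delta(N,N_s)$; an optimal solution for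 $T$ is a CPT for $V_n$ (any parent set $\subseteq\{V_1,\ldots,V_{n-1}\}$) minimizing $f_T$. The instance $T^{k,n}=(N_1,\ldots,N_t)$, for $n\ge3$, $k\in\{2,\ldots,n-1\}$, has $t=\binom{n-1}{k}2^k$, with the indices $s$ in bijection with the pairs $(P,\gamma)$ where $P$ is a $k$-element subset of $\{V_1,\ldots,V_{n-1}\}$ and $\gamma\in\mathrm{Inst}(P)$; the CPT $N_s$ corresponding to $(P,\gamma)$ has parent set $P$, the rule $\gamma:1\succ0$, and the rule $\gamma':0\succ1$ for every $\gamma'\in\mathrm{Inst}(P)\setminus\{\gamma\}$. -}

module Defs where

open import Data.Bool using (Bool; true; false; if_then_else_; _xor_; _∧_)
open import Data.Nat using (ℕ; zero; suc; _+_; _∸_)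
open import Data.Unit using (⊤; tt)
open import Data.Product using (_×_; _,_)
open import Data.List using (List; []; _∷_; map; concatMap; filter; length; lookup)
open import Data.Nat.ListAction using (sum)
open import Data.Vec using (Vec; []; _∷_)
open import Data.Fin using (Fin)
open import Data.Fin.Subset using (Subset; ∣_∣)
open import Data.Nat using (_≟_)

-- Attributes V_1,…,V_{m} (with m = n-1) are indexed by Fin m.
-- Value 0 is 'false', value 1 is 'true'.
-- A swap over V_n is an element of {0,1}^m, i.e. Vec Bool m.

Inst : ∀ {m} → Subset m → Set
Inst []           = ⊤
Inst (true ∷ P)   = Bool × Inst P
Inst (false ∷ P)  = Inst P

restrict : ∀ {m} → Vec Bool m → (P : Subset m) → Inst P
restrict []      []          = tt
restrict (b ∷ x) (true ∷ P)  = b , restrict x P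
restrict (b ∷ x) (false ∷ P) = restrict x P

allInst : ∀ {m} → (P : Subset m) → List (Inst P)
allInst []          = tt ∷ []
allInst (true ∷ P)  = concatMap (λ g → (false , g) ∷ (true , g) ∷ []) (allInst P)
allInst (false ∷ P) = allInst P

eqInst : ∀ {m} → (P : Subset m) → Inst P → Inst P → Bool
eqInst []          _        _        = true
eqInst (true ∷ P)  (a , g)  (b , h)  = (if a then b else (if b then false else true)) ∧ eqInst P g h
eqInst (false ∷ P) g        h        = eqInst P g h

-- A complete CPT for V_n: a parent set and exactly one rule per context.
-- rule γ = true  means  γ : 1 ≻ 0 ;  rule γ = false  means  γ : 0 ≻ 1.
record CPT (m : ℕ) : Set where
  constructor cpt
  field
    parents : Subset m
    rule    : Inst parents → Bool
open CPT public

vote : ∀ {m} → CPT m → Vec Bool m → Bool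
vote N x = rule N (restrict x (parents N))

allVecs : (m : ℕ) → List (Vec Bool m)
allVecs zero    = [] ∷ []
allVecs (suc m) = concatMap (λ v → (false ∷ v) ∷ (true ∷ v) ∷ []) (allVecs m)

Δ : ∀ {m} → CPT m → CPT m → ℕ
Δ {m} N N' = sum (map (λ x → if vote N x xor vote N' x then 1 else 0) (allVecs m))

f : ∀ {m} → List (CPT m) → CPT m → ℕ
f T N = sum (map (Δ N) T)

Nsingle : ∀ {m} → (P : Subset m) → Inst P → CPT m
Nsingle P γ = cpt P (λ γ' → eqInst P γ γ')

kSubsets : (m k : ℕ) → List (Subset m)
kSubsets m k = filter (λ P → ∣ P ∣ ≟ k) (allVecs m)

Tkn : (k n : ℕ) → List (CPT (n ∸ 1))
Tkn k n = concatMap (λ P → map (Nsingle P) (allInst P)) (kSubsets (n ∸ 1) k)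

Nth : ∀ {m} → (T : List (CPT m)) → Fin (length T) → CPT m
Nth T s = lookup T s

module Submission where

-- f_T(N) is a sum over swaps x of the number of N_s whose vote on x differs
-- from N's.  On any swap x and for any k-set P, exactly one of the 2^k CPTs
-- N_{(P,γ)} votes 1 on x (the one with γ = x|P), so voting 0 never loses and the
-- parentless CPT that always votes 0 is a global optimum for T^{k,n}.  Its parent
-- set is contained in every Pa(N_s), so each N*_s is already globally optimal
-- and the choice of s* made by Algorithm 1 is irrelevant.

open import Defs
open import Data.Nat using (ℕ; _≤_; _∸_)
open import Data.List using (length)
open import Data.Fin using (Fin)
open import Data.Fin.Subset using (_⊆_)
open import Relation.Binary.PropositionalEquality using (_≡_)

open import Function using (_∘_)
open import Data.Bool using (Bool; true; false; if_then_else_; _xor_; _∧_)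
open import Data.Nat using (_+_; z≤n; s≤s; _≟_)
open import Data.Nat.Properties using (≤-refl; ≤-trans; +-mono-≤; +-commutativeSemigroup)
open import Data.Nat.ListAction using (sum)
open import Data.Nat.ListAction.Properties using (sum-++)
open import Data.List using (List; []; _∷_; _++_; map; concatMap)
open import Data.List.Properties using (map-++; map-∘)
open import Data.List.Relation.Unary.All as All using (All; []; _∷_)
open import Data.List.Relation.Unary.All.Properties using (all-filter)
open import Data.Vec using (Vec; []; _∷_)
open import Data.Product using (_,_)
open import Data.Fin.Subset using (Subset; ∣_∣; ⊥)
open import Data.Fin.Subset.Properties using (⊥⊆)
open import Relation.Binary.PropositionalEquality using (refl; sym; trans; cong; subst; subst₂; module ≡-Reasoning)
open import Algebra.Properties.CommutativeSemigroup +-commutativeSemigroup using (interchange)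

disagree : Bool → Bool → ℕ
disagree a b = if a xor b then 1 else 0

module _ {A : Set} where

  sum-map-mono : {g h : A → ℕ} {xs : List A} →
    All (λ a → g a ≤ h a) xs → sum (map g xs) ≤ sum (map h xs)
  sum-map-mono []         = z≤n
  sum-map-mono (gh ∷ ghs) = +-mono-≤ gh (sum-map-mono ghs)

  sum-map-+ : (g h : A → ℕ) (xs : List A) →
    sum (map (λ a → g a + h a) xs) ≡ sum (map g xs) + sum (map h xs)
  sum-map-+ g h []       = refl
  sum-map-+ g h (a ∷ xs) = trans (cong (g a + h a +_) (sum-map-+ g h xs))
    (interchange (g a) (h a) (sum (map g xs)) (sum (map h xs)))

  sum-map-zero : (xs : List A) → sum (map (λ _ → 0) xs) ≡ 0
  sum-map-zero []       = refl
  sum-map-zero (_ ∷ xs) = sum-map-zero xs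

module _ {A B : Set} where

  sum-map-∘ : (g : B → ℕ) (h : A → B) (xs : List A) →
    sum (map g (map h xs)) ≡ sum (map (g ∘ h) xs)
  sum-map-∘ g h xs = cong sum (sym (map-∘ xs))

  sum-map-concatMap : (g : B → ℕ) (h : A → List B) (xs : List A) →
    sum (map g (concatMap h xs)) ≡ sum (map (λ a → sum (map g (h a))) xs)
  sum-map-concatMap g h []       = refl
  sum-map-concatMap g h (a ∷ xs) = begin
    sum (map g (h a ++ concatMap h xs))             ≡⟨ cong sum (map-++ g (h a) (concatMap h xs)) ⟩
    sum (map g (h a) ++ map g (concatMap h xs))     ≡⟨ sum-++ (map g (h a)) (map g (concatMap h xs)) ⟩
    sum (map g (h a)) + sum (map g (concatMap h xs)) ≡⟨ cong (sum (map g (h a)) +_) (sum-map-concatMap g h xs) ⟩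
    sum (map g (h a)) + sum (map (λ a → sum (map g (h a))) xs) ∎
    where open ≡-Reasoning

  sum-map-swap : (g : A → B → ℕ) (xs : List A) (ys : List B) →
    sum (map (λ a → sum (map (g a) ys)) xs) ≡ sum (map (λ b → sum (map (λ a → g a b) xs)) ys)
  sum-map-swap g []       ys = sym (sum-map-zero ys)
  sum-map-swap g (a ∷ xs) ys =
    trans (cong (sum (map (g a) ys) +_) (sum-map-swap g xs ys))
          (sym (sum-map-+ (g a) (λ b → sum (map (λ a → g a b) xs)) ys))

cost : ∀ {m} → List (CPT m) → Vec Bool m → Bool → ℕ
cost T x b = sum (map (λ M → disagree b (vote M x)) T)

f≡sum-cost : ∀ {m} (T : List (CPT m)) (N : CPT m) →
  f T N ≡ sum (map (λ x → cost T x (vote N x)) (allVecs m))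
f≡sum-cost {m} T N = sum-map-swap (λ M x → disagree (vote N x) (vote M x)) T (allVecs m)

cost-≤⇒f-≤ : ∀ {m} (T : List (CPT m)) (N₀ N : CPT m) →
  (∀ x → cost T x (vote N₀ x) ≤ cost T x (vote N x)) → f T N₀ ≤ f T N
cost-≤⇒f-≤ {m} T N₀ N cost-≤ =
  subst₂ _≤_ (sym (f≡sum-cost T N₀)) (sym (f≡sum-cost T N))
    (sum-map-mono (All.universal cost-≤ (allVecs m)))

zeroCPT : ∀ {m} → CPT m
zeroCPT = cpt ⊥ (λ _ → false)

vote-zeroCPT : ∀ {m} (x : Vec Bool m) → vote zeroCPT x ≡ false
vote-zeroCPT []      = refl
vote-zeroCPT (_ ∷ x) = vote-zeroCPT x

zeroCPT-optimal : ∀ {m} (T : List (CPT m)) →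
  (∀ x → cost T x false ≤ cost T x true) → (N : CPT m) → f T zeroCPT ≤ f T N
zeroCPT-optimal T cost-0≤1 N = cost-≤⇒f-≤ T zeroCPT N vote-0≤vote
  where
  vote-0≤vote : ∀ x → cost T x (vote zeroCPT x) ≤ cost T x (vote N x)
  vote-0≤vote x rewrite vote-zeroCPT x with vote N x
  ... | false = ≤-refl
  ... | true  = cost-0≤1 x

-- Splitting the contexts of a nonempty P along its first parent pairs them up,
-- and at most one context of each pair matches y.
matches≤mismatches : ∀ {m} (P : Subset m) → 1 ≤ ∣ P ∣ → (y : Inst P) →
  sum (map (λ γ → disagree false (eqInst P γ y)) (allInst P))
    ≤ sum (map (λ γ → disagree true (eqInst P γ y)) (allInst P))
matches≤mismatches (false ∷ P) 1≤∣P∣ y       = matches≤mismatches P 1≤∣P∣ y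
matches≤mismatches (true ∷ P)  _     (b , y) =
  subst₂ _≤_ (sym (sum-map-concatMap _ pair (allInst P)))
             (sym (sum-map-concatMap _ pair (allInst P)))
    (sum-map-mono (All.universal (λ γ → pair-matches≤mismatches b (eqInst P γ y)) (allInst P)))
  where
  pair : Inst P → List (Inst (true ∷ P))
  pair γ = (false , γ) ∷ (true , γ) ∷ []

  pair-matches≤mismatches : (b e : Bool) →
    disagree false ((if b then false else true) ∧ e) + (disagree false (b ∧ e) + 0)
      ≤ disagree true ((if b then false else true) ∧ e) + (disagree true (b ∧ e) + 0)
  pair-matches≤mismatches false false = z≤n
  pair-matches≤mismatches false true  = s≤s z≤n
  pair-matches≤mismatches true  false = z≤n
  pair-matches≤mismatches true  true  = s≤s z≤n

cost-Nsingle : ∀ {m} (P : Subset m) → 1 ≤ ∣ P ∣ → (x : Vec Bool m) →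
  cost (map (Nsingle P) (allInst P)) x false ≤ cost (map (Nsingle P) (allInst P)) x true
cost-Nsingle P 1≤∣P∣ x =
  subst₂ _≤_ (sym (sum-map-∘ _ (Nsingle P) (allInst P))) (sym (sum-map-∘ _ (Nsingle P) (allInst P)))
    (matches≤mismatches P 1≤∣P∣ (restrict x P))

cost-Tkn : ∀ k n → 1 ≤ k → (x : Vec Bool (n ∸ 1)) → cost (Tkn k n) x false ≤ cost (Tkn k n) x true
cost-Tkn k n 1≤k x =
  subst₂ _≤_ (sym (sum-map-concatMap _ block subsets)) (sym (sum-map-concatMap _ block subsets))
    (sum-map-mono (All.map (λ {P} ∣P∣≡k → cost-Nsingle P (subst (1 ≤_) (sym ∣P∣≡k) 1≤k) x)
                           (all-filter (λ P → ∣ P ∣ ≟ k) (allVecs (n ∸ 1)))))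
  where
  subsets : List (Subset (n ∸ 1))
  subsets = kSubsets (n ∸ 1) k
  block : Subset (n ∸ 1) → List (CPT (n ∸ 1))
  block P = map (Nsingle P) (allInst P)

theorem16 : (n k : ℕ) → 3 ≤ n → 2 ≤ k → k ≤ n ∸ 1 →
    (Nstar : Fin (length (Tkn k n)) → CPT (n ∸ 1)) →
    (∀ s → parents (Nstar s) ⊆ parents (Nth (Tkn k n) s)) →
    (∀ s (N : CPT (n ∸ 1)) → parents N ⊆ parents (Nth (Tkn k n) s) →
      f (Tkn k n) (Nstar s) ≤ f (Tkn k n) N) →
    (sstar : Fin (length (Tkn k n))) →
    (∀ s → f (Tkn k n) (Nstar sstar) ≤ f (Tkn k n) (Nstar s)) →
    (Na : CPT (n ∸ 1)) → Na ≡ Nstar sstar →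
    (N : CPT (n ∸ 1)) → f (Tkn k n) Na ≤ f (Tkn k n) N
theorem16 n k _ 2≤k _ Nstar _ Nstar-optimal sstar _ Na refl N =
  ≤-trans (Nstar-optimal sstar zeroCPT ⊥⊆)
          (zeroCPT-optimal (Tkn k n) (cost-Tkn k n (≤-trans (s≤s z≤n) 2≤k)) N)
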